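{- Let $\mathfrak D$ be a unique factorization domain of characteristic zero. Then every nice polynomial of degree $3$ over $\mathfrak D$ is totally nice.
   Context: A polynomial of positive degree $n$ splits over $\mathfrak D$ if it equals $c\prod_{i=1}^n(x-x_i)$ with $c,x_1,\dots,x_n\in\mathfrak D$, $c\ne0$. A polynomial $p\in\mathfrak D[x]$ of degree $d\ge2$ is nice if $p$ and its formal derivative $p'$ split over $\mathfrak D$, and totally nice if $p,p',\dots,p^{(d-1)}$ all split over $\mathfrak D$. -}

module Defs where

open import Level using (Level; _⊔_)
open import Algebra.Bundles using (CommutativeRing; Semiring)
open import Data.Nat using (ℕ; zero; suc)
open import Data.Empty using (⊥)
open import Data.Sum using (_⊎_)
open import Data.Product using (Σ; ∃; ∃-syntax; _×_; _,_)
open import Data.List using (List; foldr)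
open import Data.List.Relation.Unary.All using (All)
open import Data.List.Relation.Binary.Pointwise as LP using ()
open import Data.List.Relation.Binary.Permutation.Propositional using (_↭_)
open import Data.Vec using (Vec; []; _∷_; last)
open import Data.Vec.Relation.Binary.Pointwise.Inductive as VP using ()
open import Relation.Nullary using (¬_)
open import Relation.Binary.PropositionalEquality using (_≡_)

module _ {c ℓ : Level} (R : CommutativeRing c ℓ) where
  open CommutativeRing R
  open import Algebra.Definitions.RawSemiring (Semiring.rawSemiring semiring)
    using (Irreducible; _∣_) renaming (_×_ to _·_)
  open import Algebra.Definitions.RawMagma *-rawMagma using (_∥_)

  IsIntegralDomain : Set (c ⊔ ℓ)
  IsIntegralDomain =
    (¬ (1# ≈ 0#)) ×
    (∀ a b → a * b ≈ 0# → (a ≈ 0#) ⊎ (b ≈ 0#))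

  listProduct : List Carrier → Carrier
  listProduct = foldr _*_ 1#

  IsIrreducible : Carrier → Set (c ⊔ ℓ)
  IsIrreducible p = (¬ (p ≈ 0#)) × Irreducible p

  IsUFD : Set (c ⊔ ℓ)
  IsUFD =
    IsIntegralDomain ×
    ((∀ a → ¬ (a ≈ 0#) → ¬ (a ∣ 1#) →
        ∃[ xs ] (All IsIrreducible xs × (a ≈ listProduct xs))) ×
     (∀ xs ys → All IsIrreducible xs → All IsIrreducible ys →
        listProduct xs ≈ listProduct ys →
        ∃[ zs ] ((zs ↭ ys) × LP.Pointwise _∥_ xs zs)))

  CharZero : Set ℓ
  CharZero = ∀ (n : ℕ) → (n · 1#) ≈ 0# → n ≡ 0

  -- Polynomials: a polynomial of formal degree ≤ n is its coefficient
  -- vector (a₀ ∷ a₁ ∷ … ∷ aₙ), a_i the coefficient of x^i.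

  Poly : ℕ → Set c
  Poly n = Vec Carrier (suc n)

  HasDegree : ∀ {n} → Poly n → Set ℓ
  HasDegree p = ¬ (last p ≈ 0#)

  derivAux : ∀ {n} → ℕ → Vec Carrier n → Vec Carrier n
  derivAux k [] = []
  derivAux k (a ∷ as) = (k · a) ∷ derivAux (suc k) as

  deriv : ∀ {n} → Poly (suc n) → Poly n
  deriv (a₀ ∷ as) = derivAux 1 as

  -- multiplication by the linear factor (x - r)
  addHead : ∀ {m} → Carrier → Vec Carrier (suc m) → Vec Carrier (suc m)
  addHead a (h ∷ t) = (a + h) ∷ t

  mulLin : ∀ {n} → Carrier → Poly n → Poly (suc n)
  mulLin r (q ∷ []) = (- (r * q)) ∷ q ∷ []
  mulLin r (q ∷ q′ ∷ qs) = (- (r * q)) ∷ addHead q (mulLin r (q′ ∷ qs))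

  prodLin : ∀ {n} → Carrier → Vec Carrier n → Poly n
  prodLin k [] = k ∷ []
  prodLin k (r ∷ rs) = mulLin r (prodLin k rs)

  Splits : ∀ {n} → Poly (suc n) → Set (c ⊔ ℓ)
  Splits {n} p = Σ Carrier λ k → Σ (Vec Carrier (suc n)) λ xs →
    (¬ (k ≈ 0#)) × VP.Pointwise _≈_ p (prodLin k xs)

  Nice : ∀ {n} → Poly (suc (suc n)) → Set (c ⊔ ℓ)
  Nice p = Splits p × Splits (deriv p)

  AllDerivsSplit : ∀ {m} → Poly (suc m) → Set (c ⊔ ℓ)
  AllDerivsSplit {zero} p = Splits p
  AllDerivsSplit {suc m} p = Splits p × AllDerivsSplit (deriv p)

  TotallyNice : ∀ {n} → Poly (suc (suc n)) → Set (c ⊔ ℓ)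
  TotallyNice p = AllDerivsSplit p

-- Write σ and ρ for the root sums of p = a₀ + a₁x + a₂x² + a₃x³ and of p′. Comparing the
-- coefficients of x² in p and of x in p′ with their factorisations (Vieta) gives a₂ = −σa₃
-- and 2a₂ = −3ρa₃. The linear p″ = 2a₂ + 6a₃x has the root −a₂/(3a₃) = σ/3, which these two
-- relations turn into the ring element σ − ρ, with no division. Its leading coefficient 6a₃
-- is nonzero because 𝔇 is a domain of characteristic zero.

module Submission where

open import Defs
open import Level using (Level)
open import Algebra.Bundles using (CommutativeRing; Semiring)
open import Data.Nat using (zero; suc)
open import Data.Product using (∃-syntax; _,_)
open import Data.Sum using (inj₁; inj₂)
open import Data.Vec using (Vec; []; _∷_; last)
open import Data.Vec.Relation.Binary.Pointwise.Inductive using (Pointwise; []; _∷_)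
open import Relation.Nullary using (¬_)
open import Relation.Binary.PropositionalEquality as ≡ using (_≡_)
import Algebra.Properties.Ring as RingProperties
import Algebra.Properties.Semiring.Mult as SemiringMult
import Algebra.Solver.Ring.NaturalCoefficients.Default as NaturalSolver
import Relation.Binary.Reasoning.Setoid as SetoidReasoning

module _ {c ℓ : Level} (R : CommutativeRing c ℓ) where
  open CommutativeRing R
  open import Algebra.Definitions.RawSemiring (Semiring.rawSemiring semiring)
    using () renaming (_×_ to _·_)
  open RingProperties ring using (-0#≈0#; -‿+-comm; -‿involutive; ⁻¹-anti-homo‿-; [y-z]x≈yx-zx)
  open SemiringMult semiring using (×-congʳ; ×-assoc-*; ×-homo-1)
  open NaturalSolver commutativeSemiring using (solve; _:=_; _:*_; _:×_)
  open SetoidReasoning setoid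

  sum : ∀ {n} → Vec Carrier n → Carrier
  sum []       = 0#
  sum (x ∷ xs) = x + sum xs

  subleading : ∀ {n} → Poly R (suc n) → Carrier
  subleading (a ∷ _ ∷ [])     = a
  subleading (_ ∷ a ∷ b ∷ as) = subleading (a ∷ b ∷ as)

  subleading-∷ : ∀ {n} a (p : Poly R (suc n)) → subleading (a ∷ p) ≡ subleading p
  subleading-∷ a (_ ∷ _ ∷ _) = ≡.refl

  last-addHead : ∀ {n} a (p : Poly R (suc n)) → last (addHead R a p) ≡ last p
  last-addHead a (_ ∷ _) = ≡.refl

  subleading-addHead : ∀ {n} a (p : Poly R (suc (suc n))) →
    subleading (addHead R a p) ≡ subleading p
  subleading-addHead a (_ ∷ _ ∷ _ ∷ _) = ≡.refl

  last-mulLin : ∀ {n} r (q : Poly R n) → last (mulLin R r q) ≡ last q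
  last-mulLin r (q ∷ [])      = ≡.refl
  last-mulLin r (q ∷ q′ ∷ qs) =
    ≡.trans (last-addHead q (mulLin R r (q′ ∷ qs))) (last-mulLin r (q′ ∷ qs))

  subleading-mulLin : ∀ {n} r (q : Poly R (suc n)) →
    subleading (mulLin R r q) ≈ subleading q - r * last q
  subleading-mulLin r (q₀ ∷ q₁ ∷ [])      = refl
  subleading-mulLin r (q₀ ∷ q₁ ∷ q₂ ∷ qs) = begin
    subleading (mulLin R r (q₀ ∷ q₁ ∷ q₂ ∷ qs))
      ≡⟨ ≡.trans (subleading-∷ _ (addHead R q₀ q′)) (subleading-addHead q₀ q′) ⟩
    subleading q′
      ≈⟨ subleading-mulLin r (q₁ ∷ q₂ ∷ qs) ⟩
    subleading (q₁ ∷ q₂ ∷ qs) - r * last (q₁ ∷ q₂ ∷ qs) ∎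
    where q′ = mulLin R r (q₁ ∷ q₂ ∷ qs)

  last-prodLin : ∀ {n} k (xs : Vec Carrier n) → last (prodLin R k xs) ≡ k
  last-prodLin k []       = ≡.refl
  last-prodLin k (x ∷ xs) = ≡.trans (last-mulLin x (prodLin R k xs)) (last-prodLin k xs)

  subleading-prodLin : ∀ {n} k (xs : Vec Carrier (suc n)) →
    subleading (prodLin R k xs) ≈ - (sum xs * k)
  subleading-prodLin k (x ∷ [])     = -‿cong (*-congʳ (sym (+-identityʳ x)))
  subleading-prodLin k (x ∷ y ∷ ys) = begin
    subleading (mulLin R x (prodLin R k (y ∷ ys)))
      ≈⟨ subleading-mulLin x (prodLin R k (y ∷ ys)) ⟩
    subleading (prodLin R k (y ∷ ys)) - x * last (prodLin R k (y ∷ ys))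
      ≈⟨ +-cong (subleading-prodLin k (y ∷ ys))
                (-‿cong (*-congˡ (reflexive (last-prodLin k (y ∷ ys))))) ⟩
    - (σ * k) - x * k
      ≈⟨ -‿+-comm (σ * k) (x * k) ⟩
    - (σ * k + x * k)
      ≈⟨ -‿cong (trans (+-comm _ _) (sym (distribʳ k x σ))) ⟩
    - ((x + σ) * k) ∎
    where σ = sum (y ∷ ys)

  last-cong : ∀ {n} {p q : Vec Carrier (suc n)} → Pointwise _≈_ p q → last p ≈ last q
  last-cong (p≈q ∷ [])         = p≈q
  last-cong (_ ∷ p≈q ∷ ps≈qs) = last-cong (p≈q ∷ ps≈qs)

  subleading-cong : ∀ {n} {p q : Poly R (suc n)} →
    Pointwise _≈_ p q → subleading p ≈ subleading q
  subleading-cong (p≈q ∷ _ ∷ [])           = p≈q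
  subleading-cong (_ ∷ p≈q ∷ p≈q′ ∷ ps≈qs) = subleading-cong (p≈q ∷ p≈q′ ∷ ps≈qs)

  splits⇒subleading≈-sum*last : ∀ {n} (p : Poly R (suc n)) → Splits R p →
    ∃[ σ ] subleading p ≈ - (σ * last p)
  splits⇒subleading≈-sum*last p (k , xs , _ , p≈∏) = sum xs , (begin
    subleading p                ≈⟨ subleading-cong p≈∏ ⟩
    subleading (prodLin R k xs) ≈⟨ subleading-prodLin k xs ⟩
    - (sum xs * k)              ≈⟨ -‿cong (*-congˡ k≈last) ⟩
    - (sum xs * last p)         ∎)
    where
    k≈last : k ≈ last p
    k≈last = sym (trans (last-cong p≈∏) (reflexive (last-prodLin k xs)))

  ·-neg : ∀ n x → n · (- x) ≈ - (n · x)
  ·-neg zero    x = sym -0#≈0#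
  ·-neg (suc n) x = trans (+-congˡ (·-neg n x)) (-‿+-comm x (n · x))

  suc·x-·x≈x : ∀ n x → suc n · x - n · x ≈ x
  suc·x-·x≈x n x =
    trans (+-assoc x (n · x) _) (trans (+-congˡ (-‿inverseʳ (n · x))) (+-identityʳ x))

  root-of-second-derivative : ∀ {a₂ a₃} σ ρ →
    a₂ ≈ - (σ * a₃) → 2 · a₂ ≈ - (ρ * (3 · a₃)) →
    1 · (2 · a₂) ≈ - ((σ - ρ) * (2 · (3 · a₃)))
  root-of-second-derivative {a₂} {a₃} σ ρ a₂≈ 2a₂≈ = begin
    1 · (2 · a₂)                        ≈⟨ ×-homo-1 (2 · a₂) ⟩
    2 · a₂                              ≈⟨ suc·x-·x≈x 2 (2 · a₂) ⟨
    3 · (2 · a₂) - 2 · (2 · a₂)         ≈⟨ +-cong 3·2a₂≈ (-‿cong 2·2a₂≈) ⟩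
    - (σ * N) - - (ρ * N)               ≈⟨ trans (+-congˡ (-‿involutive _)) (+-comm _ _) ⟩
    ρ * N - σ * N                       ≈⟨ ⁻¹-anti-homo‿- (σ * N) (ρ * N) ⟨
    - (σ * N - ρ * N)                   ≈⟨ -‿cong ([y-z]x≈yx-zx N σ ρ) ⟨
    - ((σ - ρ) * N)                     ∎
    where
    N = 2 · (3 · a₃)
    3·2a₂≈ : 3 · (2 · a₂) ≈ - (σ * N)
    3·2a₂≈ = begin
      3 · (2 · a₂)             ≈⟨ ×-congʳ 3 (×-congʳ 2 a₂≈) ⟩
      3 · (2 · - (σ * a₃))     ≈⟨ trans (×-congʳ 3 (·-neg 2 _)) (·-neg 3 _) ⟩
      - (3 · (2 · (σ * a₃)))
        ≈⟨ -‿cong (solve 2 (λ σ a → 3 :× (2 :× (σ :* a)) := σ :* (2 :× (3 :× a))) refl σ a₃) ⟩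
      - (σ * N)                ∎
    2·2a₂≈ : 2 · (2 · a₂) ≈ - (ρ * N)
    2·2a₂≈ = begin
      2 · (2 · a₂)             ≈⟨ trans (×-congʳ 2 2a₂≈) (·-neg 2 _) ⟩
      - (2 · (ρ * (3 · a₃)))
        ≈⟨ -‿cong (solve 2 (λ ρ a → 2 :× (ρ :* (3 :× a)) := ρ :* (2 :× (3 :× a))) refl ρ a₃) ⟩
      - (ρ * N)                ∎

  ·-nonzero : IsIntegralDomain R → CharZero R → ∀ n {a} → ¬ a ≈ 0# → ¬ suc n · a ≈ 0#
  ·-nonzero (_ , noZeroDivisors) charZero n {a} a≉0 n·a≈0
    with noZeroDivisors (suc n · 1#) a
           (trans (×-assoc-* (suc n) 1# a) (trans (×-congʳ (suc n) (*-identityˡ a)) n·a≈0))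
  ... | inj₁ n·1≈0 with () ← charZero (suc n) n·1≈0
  ... | inj₂ a≈0 = a≉0 a≈0

  linear-splits : ∀ {b₀ b₁} t → ¬ b₁ ≈ 0# → b₀ ≈ - (t * b₁) → Splits R (b₀ ∷ b₁ ∷ [])
  linear-splits {b₁ = b₁} t b₁≉0 b₀≈ = b₁ , t ∷ [] , b₁≉0 , b₀≈ ∷ refl ∷ []

corollary4p2 : {c ℓ : Level} (R : CommutativeRing c ℓ) →
    IsUFD R → CharZero R →
    (p : Poly R 3) → HasDegree R p → Nice R p → TotallyNice R p
corollary4p2 R (domain , _) charZero p@(_ ∷ _ ∷ _ ∷ _ ∷ []) a₃≉0 (p-splits , p′-splits)
  with σ , a₂≈ ← splits⇒subleading≈-sum*last R p p-splits
     | ρ , 2a₂≈ ← splits⇒subleading≈-sum*last R (deriv R p) p′-splits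
  = p-splits , p′-splits ,
    linear-splits R (σ - ρ) (·-nonzero R domain charZero 1 (·-nonzero R domain charZero 2 a₃≉0))
      (root-of-second-derivative R σ ρ a₂≈ 2a₂≈)
  where open CommutativeRing R using (_-_)
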